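{- Let $k\ge 1$, $p\ge k$ and $q\ge p$ be integers. Then for every $(Q,P)\in\Gamma(q,p,k)$ there exists $(N,D)\in\Delta(q,p,k)$ such that $R^*(N,D)=R^*(Q,P)$ and $R(N,D)=R(Q,P)$.
   Context: For a positive integer $q$, $\Sigma_q=\{0,\ldots,q-1\}$. An array is a finite sequence of rows (words of fixed length). Condition $(k_=)$ for a pair $(A,B)$ of arrays: for every choice of $k$ columns, extracting them from $A$ and from $B$ gives the same array up to the order of rows. $\Gamma(q,p,k)$ is the set of pairs $(Q,P)$ of arrays with $q$ columns over $\Sigma_q$ such that $Q$ contains at least one occurrence of the row $(0,1,\ldots,q-1)$, each row of $P$ involves at most $p$ distinct symbols, and $(Q,P)$ satisfies $(k_=)$; $R^*(Q,P)$ is the number of occurrences of $(0,1,\ldots,q-1)$ in $Q$ and $R(Q,P)$ the number of rows of $P$. $\Delta(\nu,d,k)$ is the set of pairs $(N,D)$ of arrays with $\nu$ columns over $\{0,1\}$ such that $N$ contains at least one all-ones row, each row of $D$ has at most $d$ non-zero coordinates, and $(N,D)$ satisfies $(k_=)$; $R^*(N,D)$ is the number of all-ones rows in $N$ and $R(N,D)$ the number of rows of $D$. -}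

module Defs where

open import Data.Nat using (ℕ; zero; suc; _≤_; _<_)
open import Data.Fin using (Fin; toℕ; _≟_) renaming (_<_ to _<ᶠ_)
open import Data.Fin.Patterns using (0F)
open import Data.Vec using (Vec; []; _∷_; lookup; map; toList; allFin)
open import Data.List using (List; length; filter; deduplicate)
import Data.List as L
open import Data.List.Relation.Binary.Permutation.Propositional using (_↭_)
open import Data.List.Membership.Propositional using (_∈_)
open import Data.Product using (Σ; _×_; _,_)
open import Relation.Binary.PropositionalEquality using (_≡_)
open import Relation.Nullary using (¬_)
open import Relation.Nullary.Decidable using (¬?)

-- Σ_s = Fin s. A row with n columns over Σ_s is a Vec (Fin s) n.
Row : ℕ → ℕ → Set
Row s n = Vec (Fin s) n

Array : ℕ → ℕ → Set
Array s n = List (Row s n)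

data Increasing {n : ℕ} : {k : ℕ} → Vec (Fin n) k → Set where
  inc[]  : Increasing []
  inc[_] : (i : Fin n) → Increasing (i ∷ [])
  inc∷   : ∀ {k} {i j : Fin n} {is : Vec (Fin n) k} →
           i <ᶠ j → Increasing (j ∷ is) → Increasing (i ∷ j ∷ is)

ColumnChoice : ℕ → ℕ → Set
ColumnChoice n k = Σ (Vec (Fin n) k) Increasing

extractRow : ∀ {s n k} → Vec (Fin n) k → Row s n → Row s k
extractRow cs r = map (λ c → lookup r c) cs

extract : ∀ {s n k} → Vec (Fin n) k → Array s n → Array s k
extract cs A = L.map (extractRow cs) A

CondEq : ∀ {s n} (k : ℕ) → Array s n → Array s n → Set
CondEq {s} {n} k A B = (c : ColumnChoice n k) →
  extract (Data.Product.proj₁ c) A ↭ extract (Data.Product.proj₁ c) B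

distinctSymbols : ∀ {s n} → Row s n → ℕ
distinctSymbols r = length (deduplicate _≟_ (toList r))

nonZeros : ∀ {n} → Row 2 n → ℕ
nonZeros r = length (filter (λ x → ¬? (x ≟ 0F)) (toList r))

identityRow : (q : ℕ) → Row q q
identityRow q = allFin q

onesRow : (ν : ℕ) → Row 2 ν
onesRow ν = Data.Vec.replicate ν (Data.Fin.suc 0F)

occurrences : ∀ {s n} → Row s n → Array s n → ℕ
occurrences r A = length (filter (λ x → Data.Vec.Properties.≡-dec _≟_ x r) A)
  where import Data.Vec.Properties

record InΓ (q p k : ℕ) (Q P : Array q q) : Set where
  field
    hasIdentity : identityRow q ∈ Q
    fewSymbols  : ∀ {r} → r ∈ P → distinctSymbols r ≤ p
    condEq      : CondEq k Q P

record InΔ (ν d k : ℕ) (N D : Array 2 ν) : Set where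
  field
    hasOnes     : onesRow ν ∈ N
    fewNonZeros : ∀ {r} → r ∈ D → nonZeros r ≤ d
    condEq      : CondEq k N D

RstarΓ : ∀ {q} → Array q q → Array q q → ℕ
RstarΓ {q} Q P = occurrences (identityRow q) Q

RstarΔ : ∀ {ν} → Array 2 ν → Array 2 ν → ℕ
RstarΔ {ν} N D = occurrences (onesRow ν) N

R : ∀ {s n} → Array s n → Array s n → ℕ
R A B = length B

{-# OPTIONS --safe #-}
module Submission where

-- Replace every row r by its fixed-point row i ↦ [r i = i].  The new entry in column i
-- depends only on i and the old entry there, so extracting any k columns commutes with
-- the encoding and (k_=) is preserved.  Only the identity row is sent to the all-ones row,
-- and the fixed points of r are distinct symbols of r, so a row with at most p symbols
-- becomes a row with at most p ones.

open import Defs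
open import Data.Nat using (ℕ; _≤_; zero; suc; z≤n; s≤s)
open import Data.Nat.Properties using (module ≤-Reasoning)
import Data.Fin as Fin
open Fin using (Fin; _≟_)
open import Data.Fin.Patterns using (0F; 1F)
open import Data.Product using (Σ; _×_; _,_; proj₂)
open import Data.Vec as V using (Vec)
import Data.Vec.Properties as V
open import Data.Vec.Relation.Binary.Pointwise.Extensional using (ext; Pointwise-≡⇒≡)
import Data.Vec.Membership.Propositional.Properties as V
open import Data.Vec.Membership.Propositional using () renaming (_∈_ to _∈ᵥ_)
open import Data.List as L using (List; []; _∷_; length; filter; deduplicate)
open import Data.List.Properties using (length-removeAt′; length-map; map-∘; map-cong; map-tabulate; filter-≐)
open import Data.List.Relation.Unary.Any using (here; there; index; _─_)
import Data.List.Relation.Unary.All as All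
open import Data.List.Relation.Unary.AllPairs using (_∷_)
open import Data.List.Relation.Unary.Unique.Propositional using (Unique)
open import Data.List.Relation.Unary.Unique.Propositional.Properties using (filter⁺; allFin⁺)
open import Data.List.Membership.Propositional using (_∈_)
open import Data.List.Membership.Propositional.Properties using (∈-map⁺; ∈-map⁻; ∈-filter⁻; ∈-deduplicate⁺)
open import Data.List.Relation.Binary.Subset.Propositional using (_⊆_)
open import Data.List.Relation.Binary.Permutation.Propositional using (_↭_)
open import Data.List.Relation.Binary.Permutation.Propositional.Properties using (map⁺)
open import Function using (_∘_; const; _⇔_; mk⇔; Equivalence)
open import Level using (0ℓ)
open import Relation.Binary.PropositionalEquality
  using (_≡_; _≢_; refl; sym; trans; cong; cong₂; subst; subst₂; module ≡-Reasoning)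
open import Relation.Nullary using (yes; no; contradiction; ¬?)
open import Relation.Unary using (Pred; Decidable; _≐_)

module _ {A : Set} where

  ∈-─ : ∀ {x y} {ys : List A} (x∈ys : x ∈ ys) → y ∈ ys → x ≢ y → y ∈ (ys ─ x∈ys)
  ∈-─ (here refl) (here refl) x≢y = contradiction refl x≢y
  ∈-─ (here refl) (there y∈ys) _ = y∈ys
  ∈-─ (there x∈ys) (here refl) _ = here refl
  ∈-─ (there x∈ys) (there y∈ys) x≢y = there (∈-─ x∈ys y∈ys x≢y)

  unique-⊆⇒length-≤ : ∀ {xs ys : List A} → Unique xs → xs ⊆ ys → length xs ≤ length ys
  unique-⊆⇒length-≤ {[]} _ _ = z≤n
  unique-⊆⇒length-≤ {x ∷ xs} {ys} (x∉xs ∷ !xs) xs⊆ys = begin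
    suc (length xs)          ≤⟨ s≤s (unique-⊆⇒length-≤ !xs xs⊆ys─x) ⟩
    suc (length (ys ─ x∈ys)) ≡⟨ length-removeAt′ ys (index x∈ys) ⟨
    length ys                ∎
    where
    open ≤-Reasoning
    x∈ys : x ∈ ys
    x∈ys = xs⊆ys (here refl)
    xs⊆ys─x : xs ⊆ (ys ─ x∈ys)
    xs⊆ys─x y∈xs = ∈-─ x∈ys (xs⊆ys (there y∈xs)) (All.lookup x∉xs y∈xs)

module _ {A B : Set} {P : Pred B 0ℓ} {Q : Pred A 0ℓ}
         (P? : Decidable P) (Q? : Decidable Q) (h : A → B) where

  filter-map : ∀ xs → filter P? (L.map h xs) ≡ L.map h (filter (P? ∘ h) xs)
  filter-map [] = refl
  filter-map (x ∷ xs) with P? (h x)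
  ... | yes _ = cong (h x ∷_) (filter-map xs)
  ... | no  _ = filter-map xs

  length-filter-map : (∀ x → P (h x) ⇔ Q x) →
                      ∀ xs → length (filter P? (L.map h xs)) ≡ length (filter Q? xs)
  length-filter-map P∘h⇔Q xs = begin
    length (filter P? (L.map h xs))        ≡⟨ cong length (filter-map xs) ⟩
    length (L.map h (filter (P? ∘ h) xs))  ≡⟨ length-map h (filter (P? ∘ h) xs) ⟩
    length (filter (P? ∘ h) xs)            ≡⟨ cong length (filter-≐ (P? ∘ h) Q? P∘h≐Q xs) ⟩
    length (filter Q? xs)                  ∎
    where
    open ≡-Reasoning
    P∘h≐Q : (P ∘ h) ≐ Q
    P∘h≐Q = (λ {x} → Equivalence.to (P∘h⇔Q x)) , (λ {x} → Equivalence.from (P∘h⇔Q x))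

toList-tabulate : ∀ {A : Set} {n} (f : Fin n → A) → V.toList (V.tabulate f) ≡ L.tabulate f
toList-tabulate {n = zero}  f = refl
toList-tabulate {n = suc n} f = cong (f Fin.zero ∷_) (toList-tabulate (f ∘ Fin.suc))

occurrences-map : ∀ {s t n m} (h : Row s n → Row t m) {r : Row s n} {r′ : Row t m} →
                  (∀ x → h x ≡ r′ ⇔ x ≡ r) →
                  ∀ A → occurrences r′ (L.map h A) ≡ occurrences r A
occurrences-map h = length-filter-map (λ y → V.≡-dec _≟_ y _) (λ x → V.≡-dec _≟_ x _) h

recode : ∀ {s t n} → (Fin n → Fin s → Fin t) → Row s n → Row t n
recode g r = V.tabulate (λ i → g i (V.lookup r i))

extractRow-recode : ∀ {s t n k} (g : Fin n → Fin s → Fin t) (cs : Vec (Fin n) k) (r : Row s n) →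
                    extractRow cs (recode g r) ≡ recode (g ∘ V.lookup cs) (extractRow cs r)
extractRow-recode g V.[]       r = refl
extractRow-recode g (c V.∷ cs) r =
  cong₂ V._∷_ (V.lookup∘tabulate (λ i → g i (V.lookup r i)) c) (extractRow-recode g cs r)

extract-recode : ∀ {s t n k} (g : Fin n → Fin s → Fin t) (cs : Vec (Fin n) k) (A : Array s n) →
                 extract cs (L.map (recode g) A) ≡ L.map (recode (g ∘ V.lookup cs)) (extract cs A)
extract-recode g cs A = begin
  L.map (extractRow cs) (L.map (recode g) A)               ≡⟨ map-∘ A ⟨
  L.map (extractRow cs ∘ recode g) A                       ≡⟨ map-cong (extractRow-recode g cs) A ⟩
  L.map (recode (g ∘ V.lookup cs) ∘ extractRow cs) A       ≡⟨ map-∘ A ⟩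
  L.map (recode (g ∘ V.lookup cs)) (L.map (extractRow cs) A) ∎
  where open ≡-Reasoning

CondEq-recode : ∀ {s t n} (g : Fin n → Fin s → Fin t) {k} {A B : Array s n} →
                CondEq k A B → CondEq k (L.map (recode g) A) (L.map (recode g) B)
CondEq-recode g {A = A} {B} A≈B c@(cs , _) =
  subst₂ _↭_ (sym (extract-recode g cs A)) (sym (extract-recode g cs B))
    (map⁺ (recode (g ∘ V.lookup cs)) (A≈B c))

indicator : ∀ {n} → Fin n → Fin n → Fin 2
indicator i x with x ≟ i
... | yes _ = 1F
... | no  _ = 0F

indicator≡1⇔ : ∀ {n} {i x : Fin n} → indicator i x ≡ 1F ⇔ x ≡ i
indicator≡1⇔ {i = i} {x} with x ≟ i
... | yes x≡i = mk⇔ (const x≡i) (const refl)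
... | no  x≢i = mk⇔ (λ ()) (λ x≡i → contradiction x≡i x≢i)

indicator≢0⇔ : ∀ {n} {i x : Fin n} → indicator i x ≢ 0F ⇔ x ≡ i
indicator≢0⇔ {i = i} {x} with x ≟ i
... | yes x≡i = mk⇔ (const x≡i) (const λ ())
... | no  x≢i = mk⇔ (λ 0≢0 → contradiction refl 0≢0) (λ x≡i → contradiction x≡i x≢i)

fixedPointRow : ∀ {q} → Row q q → Row 2 q
fixedPointRow = recode indicator

fixedPoint? : ∀ {q} (r : Row q q) → Decidable (λ i → V.lookup r i ≡ i)
fixedPoint? r i = V.lookup r i ≟ i

fixedPoints : ∀ {q} → Row q q → List (Fin q)
fixedPoints {q} r = filter (fixedPoint? r) (L.allFin q)

fixedPointRow≡ones⇔identity : ∀ {q} (r : Row q q) → fixedPointRow r ≡ onesRow q ⇔ r ≡ identityRow q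
fixedPointRow≡ones⇔identity {q} r = mk⇔ to from
  where
  lookup-fixedPointRow : ∀ i → V.lookup (fixedPointRow r) i ≡ indicator i (V.lookup r i)
  lookup-fixedPointRow = V.lookup∘tabulate _

  to : fixedPointRow r ≡ onesRow q → r ≡ identityRow q
  to r↦1 = Pointwise-≡⇒≡ (ext λ i → trans
    (Equivalence.to indicator≡1⇔ (begin
      indicator i (V.lookup r i)      ≡⟨ lookup-fixedPointRow i ⟨
      V.lookup (fixedPointRow r) i    ≡⟨ cong (λ v → V.lookup v i) r↦1 ⟩
      V.lookup (onesRow q) i          ≡⟨ V.lookup-replicate i 1F ⟩
      1F                              ∎))
    (sym (V.lookup-allFin i)))
    where open ≡-Reasoning

  from : r ≡ identityRow q → fixedPointRow r ≡ onesRow q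
  from refl = Pointwise-≡⇒≡ (ext λ i → trans (lookup-fixedPointRow i) (trans
    (Equivalence.from indicator≡1⇔ (V.lookup-allFin i))
    (sym (V.lookup-replicate i 1F))))

nonZeros-fixedPointRow : ∀ {q} (r : Row q q) → nonZeros (fixedPointRow r) ≡ length (fixedPoints r)
nonZeros-fixedPointRow {q} r = begin
  nonZeros (fixedPointRow r)                      ≡⟨ cong (length ∘ filter nonZero?) toList-fixedPointRow ⟩
  length (filter nonZero? (L.map h (L.allFin q))) ≡⟨ length-filter-map nonZero? (fixedPoint? r) h
                                                       (λ _ → indicator≢0⇔) (L.allFin q) ⟩
  length (fixedPoints r)                          ∎
  where
  open ≡-Reasoning
  nonZero? : Decidable (λ (y : Fin 2) → y ≢ 0F)
  nonZero? y = ¬? (y ≟ 0F)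
  h : Fin q → Fin 2
  h i = indicator i (V.lookup r i)
  toList-fixedPointRow : V.toList (fixedPointRow r) ≡ L.map h (L.allFin q)
  toList-fixedPointRow = trans (toList-tabulate h) (sym (map-tabulate (λ i → i) h))

-- The fixed points are themselves distinct symbols occurring in the row.
length-fixedPoints≤distinctSymbols : ∀ {q} (r : Row q q) → length (fixedPoints r) ≤ distinctSymbols r
length-fixedPoints≤distinctSymbols {q} r =
  unique-⊆⇒length-≤ (filter⁺ (fixedPoint? r) (allFin⁺ q)) fixedPoints⊆symbols
  where
  fixedPoints⊆symbols : fixedPoints r ⊆ deduplicate _≟_ (V.toList r)
  fixedPoints⊆symbols {i} i∈ = ∈-deduplicate⁺ _≟_ (V.∈-toList⁺
    (subst (_∈ᵥ r) (proj₂ (∈-filter⁻ (fixedPoint? r) {xs = L.allFin q} i∈)) (V.∈-lookup i r)))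

proposition1 : (k p q : ℕ) → 1 ≤ k → k ≤ p → p ≤ q →
    (Q P : Array q q) → InΓ q p k Q P →
    Σ (Array 2 q) λ N → Σ (Array 2 q) λ D →
      InΔ q p k N D × (RstarΔ N D ≡ RstarΓ Q P) × (R N D ≡ R Q P)
proposition1 k p q _ _ _ Q P γ =
  L.map fixedPointRow Q , L.map fixedPointRow P ,
  record { hasOnes = hasOnes ; fewNonZeros = fewNonZeros ; condEq = CondEq-recode indicator condEq } ,
  occurrences-map fixedPointRow fixedPointRow≡ones⇔identity Q ,
  length-map fixedPointRow P
  where
  open InΓ γ
  open ≤-Reasoning

  hasOnes : onesRow q ∈ L.map fixedPointRow Q
  hasOnes = subst (_∈ L.map fixedPointRow Q)
    (Equivalence.from (fixedPointRow≡ones⇔identity (identityRow q)) refl) (∈-map⁺ fixedPointRow hasIdentity)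

  fewNonZeros : ∀ {r} → r ∈ L.map fixedPointRow P → nonZeros r ≤ p
  fewNonZeros r∈ with x , x∈P , refl ← ∈-map⁻ fixedPointRow r∈ = begin
    nonZeros (fixedPointRow x) ≡⟨ nonZeros-fixedPointRow x ⟩
    length (fixedPoints x)     ≤⟨ length-fixedPoints≤distinctSymbols x ⟩
    distinctSymbols x          ≤⟨ fewSymbols x∈P ⟩
    p                          ∎
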